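{- For every positive integer $n$, there is a bijection between (i) the set of $n$-color compositions of $n$ in which no part has color $2$, and (ii) the set of (regular) compositions of $3n+2$ all of whose parts are congruent to $2$ modulo $3$.
   Context: A (regular) composition of $N$ is a finite sequence of positive integers with sum $N$. An $n$-color composition of $n$ is a composition $(\kappa^{(1)}, \ldots, \kappa^{(r)})$ of $n$ together with a color $c_j \in \{1, \ldots, \kappa^{(j)}\}$ assigned to each part; two are the same iff they have the same sequence of (part, color) pairs. -}

module Defs where

open import Data.Nat using (ℕ; suc; _≤_; _%_)
open import Data.Nat.ListAction using (sum)
open import Data.Fin using (Fin; toℕ)
open import Data.List using (List; map)
open import Data.List.Relation.Unary.All using (All)
open import Data.Product using (Σ; _×_; _,_; proj₁)
open import Relation.Binary.PropositionalEquality using (_≡_; _≢_)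
open import Relation.Nullary using (¬_)

Composition : ℕ → Set
Composition N = Σ (List ℕ) λ ps → All (λ p → 1 ≤ p) ps × sum ps ≡ N

-- A colored part: a part p together with a color c ∈ Fin p,
-- where c : Fin p represents the color toℕ c + 1 ∈ {1, …, p}.
ColoredPart : Set
ColoredPart = Σ ℕ Fin

color : ColoredPart → ℕ
color (p , c) = suc (toℕ c)

NColorComposition : ℕ → Set
NColorComposition n =
  Σ (List ColoredPart) λ cs → All (λ x → 1 ≤ proj₁ x) cs × sum (map proj₁ cs) ≡ n

NColorCompositionNo2 : ℕ → Set
NColorCompositionNo2 n =
  Σ (NColorComposition n) λ κ → All (λ x → color x ≢ 2) (proj₁ κ)

CompositionParts2mod3 : ℕ → Set
CompositionParts2mod3 N =
  Σ (Composition N) λ κ → All (λ p → p % 3 ≡ 2) (proj₁ κ)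

module Submission where

open import Defs
open import Data.Nat using (ℕ; _≤_; _+_; _*_)
open import Function.Bundles using (_⤖_)

open import Data.Nat using (zero; suc; z≤n; s≤s; _∸_; _%_; _/_)
open import Data.Nat.Properties
  using (+-suc; +-identityʳ; +-cancelˡ-≡; *-cancelʳ-≡; m+n∸m≡n; +-comm; *-comm; ≤-irrelevant; ≡-irrelevant)
open import Data.Nat.DivMod using (m≡m%n+[m/n]*n; [m+kn]%n≡m%n; m/n≡1+[m∸n]/n)
open import Data.Nat.ListAction using (sum)
open import Data.Nat.Tactic.RingSolver using (solve-∀)
open import Data.Fin using (Fin; toℕ; fromℕ; _↑ˡ_) renaming (zero to fzero; suc to fsuc)
open import Data.Fin.Properties using (toℕ-fromℕ; toℕ-↑ˡ)
open import Data.List using (List; []; _∷_; [_]; map; replicate; _++_)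
open import Data.List.Properties using (map-∘; map-cong; map-id-local; ++-identityʳ)
open import Data.List.Relation.Unary.All as All using (All; []; _∷_)
open import Data.List.Relation.Unary.All.Properties using (map⁺)
open import Data.Product using (Σ; _,_; proj₁)
open import Data.Empty using (⊥-elim)
open import Function using (_∘_; _↔_; case_of_)
open import Function.Bundles using (mk↔ₛ′)
open import Function.Properties.Inverse using (↔-trans; ↔⇒⤖)
open import Relation.Binary.PropositionalEquality
  using (_≡_; _≢_; refl; sym; trans; cong; cong₂; subst₂; module ≡-Reasoning)
open ≡-Reasoning

-- A colored part (p, c) other than color 2 is either (1, 1) or determined by the two numbers
-- i = c ∸ 2 (taken as 0 for c = 1) and j = p ∸ max(c, 2), of total i + j = p ∸ 2. Such a
-- part is written as the token `block i j`, and (1, 1) as `one`. A word of tokens of weight n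
-- is encoded by the composition (3a₁+2, 3i₁+2, 3j₁+2, …, 3aₘ+2, 3iₘ+2, 3jₘ+2, 3aₘ₊₁+2) of
-- 3n+2, where aₗ counts the `one`s between the blocks. Conversely, the number of parts of a
-- composition of 3n+2 into parts ≡ 2 (mod 3) is ≡ 1 (mod 3), so it splits in this shape.

data Token : Set where
  one   : Token
  block : ℕ → ℕ → Token

weight : Token → ℕ
weight one         = 1
weight (block i j) = 2 + i + j

Word : ℕ → Set
Word n = Σ (List Token) λ ts → sum (map weight ts) ≡ n

word-≡ : ∀ {n} {x y : Word n} → proj₁ x ≡ proj₁ y → x ≡ y
word-≡ {x = ts , e} {y = .ts , e′} refl = cong (ts ,_) (≡-irrelevant e e′)

fromToken : Token → ColoredPart
fromToken one               = 1 , fzero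
fromToken (block zero j)    = 2 + j , fzero
fromToken (block (suc i) j) = 3 + i + j , fsuc (fsuc (fromℕ i ↑ˡ j))

toToken : ColoredPart → Token
toToken (suc zero    , fzero)         = one
toToken (suc (suc m) , fzero)         = block 0 m
toToken (suc (suc m) , fsuc fzero)    = block 0 0  -- color 2: never used
toToken (suc (suc m) , fsuc (fsuc c)) = block (suc (toℕ c)) (m ∸ suc (toℕ c))

size-fromToken : ∀ t → proj₁ (fromToken t) ≡ weight t
size-fromToken one               = refl
size-fromToken (block zero j)    = refl
size-fromToken (block (suc i) j) = refl

color-fromToken≢2 : ∀ t → color (fromToken t) ≢ 2
color-fromToken≢2 one               ()
color-fromToken≢2 (block zero j)    ()
color-fromToken≢2 (block (suc i) j) ()

Σ-Fin-≡-fromℕ-toℕ-↑ˡ : ∀ {m} (c : Fin m) →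
  _≡_ {A = Σ ℕ Fin} (m , c) (suc (toℕ c) + (m ∸ suc (toℕ c)) , fromℕ (toℕ c) ↑ˡ (m ∸ suc (toℕ c)))
Σ-Fin-≡-fromℕ-toℕ-↑ˡ fzero    = refl
Σ-Fin-≡-fromℕ-toℕ-↑ˡ (fsuc c) = cong (λ { (k , d) → suc k , fsuc d }) (Σ-Fin-≡-fromℕ-toℕ-↑ˡ c)

fromToken-toToken : ∀ x → color x ≢ 2 → fromToken (toToken x) ≡ x
fromToken-toToken (suc zero    , fzero)         _   = refl
fromToken-toToken (suc (suc m) , fzero)         _   = refl
fromToken-toToken (suc (suc m) , fsuc fzero)    c≢2 = ⊥-elim (c≢2 refl)
fromToken-toToken (suc (suc m) , fsuc (fsuc c)) _   =
  cong (λ { (k , d) → 2 + k , fsuc (fsuc d) }) (sym (Σ-Fin-≡-fromℕ-toℕ-↑ˡ c))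

toToken-fromToken : ∀ t → toToken (fromToken t) ≡ t
toToken-fromToken one               = refl
toToken-fromToken (block zero j)    = refl
toToken-fromToken (block (suc i) j)
  rewrite toℕ-↑ˡ (fromℕ i) j | toℕ-fromℕ i | m+n∸m≡n i j = refl

-- Agda identifies any two functions out of a type it sees to be empty, such as 1 ≡ 2.
color≢2-irrelevant : ∀ x (p q : color x ≢ 2) → p ≡ q
color≢2-irrelevant (suc zero    , fzero)         p q = refl
color≢2-irrelevant (suc (suc m) , fzero)         p q = refl
color≢2-irrelevant (suc (suc m) , fsuc fzero)    p q = ⊥-elim (p refl)
color≢2-irrelevant (suc (suc m) , fsuc (fsuc c)) p q = refl

colored-positive : ∀ (x : ColoredPart) → 1 ≤ proj₁ x
colored-positive (suc p , _) = s≤s z≤n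

sum-sizes-fromToken : ∀ ts → sum (map proj₁ (map fromToken ts)) ≡ sum (map weight ts)
sum-sizes-fromToken ts = cong sum (trans (sym (map-∘ ts)) (map-cong size-fromToken ts))

map-fromToken-toToken : ∀ {cs} → All (λ x → color x ≢ 2) cs → map fromToken (map toToken cs) ≡ cs
map-fromToken-toToken {cs} no2 =
  trans (sym (map-∘ cs)) (map-id-local (All.map (λ {x} → fromToken-toToken x) no2))

sum-weights-toToken : ∀ {cs} → All (λ x → color x ≢ 2) cs →
  sum (map weight (map toToken cs)) ≡ sum (map proj₁ cs)
sum-weights-toToken {cs} no2 = begin
  sum (map weight (map toToken cs))                     ≡⟨ sum-sizes-fromToken (map toToken cs) ⟨
  sum (map proj₁ (map fromToken (map toToken cs)))      ≡⟨ cong (sum ∘ map proj₁) (map-fromToken-toToken no2) ⟩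
  sum (map proj₁ cs)                                    ∎

colored-≡ : ∀ {n} {x y : NColorCompositionNo2 n} → proj₁ (proj₁ x) ≡ proj₁ (proj₁ y) → x ≡ y
colored-≡ {x = (cs , pos , e) , no2} {y = (.cs , pos′ , e′) , no2′} refl
  rewrite All.irrelevant ≤-irrelevant pos pos′ | ≡-irrelevant e e′
        | All.irrelevant (λ {x} → color≢2-irrelevant x) no2 no2′ = refl

colored↔word : ∀ n → NColorCompositionNo2 n ↔ Word n
colored↔word n = mk↔ₛ′ to from to-from from-to
  where
  to : NColorCompositionNo2 n → Word n
  to ((cs , _ , Σcs≡n) , no2) = map toToken cs , trans (sum-weights-toToken no2) Σcs≡n

  from : Word n → NColorCompositionNo2 n
  from (ts , Σts≡n) =
    ( map fromToken ts
    , All.universal colored-positive (map fromToken ts)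
    , trans (sum-sizes-fromToken ts) Σts≡n)
    , map⁺ (All.universal color-fromToken≢2 ts)

  to-from : ∀ w → to (from w) ≡ w
  to-from (ts , _) = word-≡ (trans (sym (map-∘ ts)) (map-id-local (All.universal toToken-fromToken ts)))

  from-to : ∀ x → from (to x) ≡ x
  from-to ((cs , _) , no2) = colored-≡ (map-fromToken-toToken no2)

part : ℕ → ℕ
part k = 2 + k * 3

part-%3 : ∀ k → part k % 3 ≡ 2
part-%3 k = [m+kn]%n≡m%n 2 k 3

part-/3 : ∀ k → part k / 3 ≡ k
part-/3 zero    = refl
part-/3 (suc k) = trans (m/n≡1+[m∸n]/n {part (suc k)} (s≤s (s≤s (s≤s z≤n)))) (cong suc (part-/3 k))

part-/3-inverse : ∀ p → p % 3 ≡ 2 → part (p / 3) ≡ p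
part-/3-inverse p p%3≡2 = begin
  2 + p / 3 * 3          ≡⟨ cong (_+ p / 3 * 3) p%3≡2 ⟨
  p % 3 + p / 3 * 3      ≡⟨ m≡m%n+[m/n]*n p 3 ⟨
  p                      ∎

part-injective : ∀ {a b} → part a ≡ part b → a ≡ b
part-injective {a} {b} eq = *-cancelʳ-≡ a b 3 (+-cancelˡ-≡ 2 (a * 3) (b * 3) eq)

part≡3*+2 : ∀ n → part n ≡ 3 * n + 2
part≡3*+2 n = trans (+-comm 2 (n * 3)) (cong (_+ 2) (*-comm n 3))

%3≡2⇒positive : ∀ {p} → p % 3 ≡ 2 → 1 ≤ p
%3≡2⇒positive {zero}  ()
%3≡2⇒positive {suc p} _ = s≤s z≤n

two-parts-%3 : ∀ p q → p % 3 ≡ 2 → q % 3 ≡ 2 → (p + (q + 0)) % 3 ≡ 1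
two-parts-%3 p q p%3≡2 q%3≡2 =
  subst₂ (λ x y → (x + (y + 0)) % 3 ≡ 1) (part-/3-inverse p p%3≡2) (part-/3-inverse q q%3≡2)
    (trans (cong (_% 3) (identity (p / 3) (q / 3))) ([m+kn]%n≡m%n 1 (1 + p / 3 + q / 3) 3))
  where
  identity : ∀ a b → (2 + a * 3) + ((2 + b * 3) + 0) ≡ 1 + (1 + a + b) * 3
  identity = solve-∀

three-parts-%3 : ∀ p q r s → p % 3 ≡ 2 → q % 3 ≡ 2 → r % 3 ≡ 2 → (p + (q + (r + s))) % 3 ≡ s % 3
three-parts-%3 p q r s p%3≡2 q%3≡2 r%3≡2 = begin
  (p + (q + (r + s))) % 3                      ≡⟨ cong (_% 3) parts ⟨
  (part a + (part b + (part c + s))) % 3       ≡⟨ cong (_% 3) (identity a b c s) ⟩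
  (s + (2 + a + b + c) * 3) % 3                ≡⟨ [m+kn]%n≡m%n s (2 + a + b + c) 3 ⟩
  s % 3                                        ∎
  where
  a = p / 3
  b = q / 3
  c = r / 3
  parts : part a + (part b + (part c + s)) ≡ p + (q + (r + s))
  parts = cong₂ _+_ (part-/3-inverse p p%3≡2)
            (cong₂ _+_ (part-/3-inverse q q%3≡2) (cong (_+ s) (part-/3-inverse r r%3≡2)))
  identity : ∀ a b c s → (2 + a * 3) + ((2 + b * 3) + ((2 + c * 3) + s)) ≡ s + (2 + a + b + c) * 3
  identity = solve-∀

data LengthOneMod3 {A : Set} : List A → Set where
  single : ∀ x → LengthOneMod3 (x ∷ [])
  cons₃  : ∀ x y z {xs} → LengthOneMod3 xs → LengthOneMod3 (x ∷ y ∷ z ∷ xs)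

sum-%3≡2⇒lengthOneMod3 : ∀ {ps} → All (λ p → p % 3 ≡ 2) ps → sum ps % 3 ≡ 2 → LengthOneMod3 ps
sum-%3≡2⇒lengthOneMod3 [] ()
sum-%3≡2⇒lengthOneMod3 {p ∷ []} _ _ = single p
sum-%3≡2⇒lengthOneMod3 {p ∷ q ∷ []} (p%3≡2 ∷ q%3≡2 ∷ []) Σ%3≡2 =
  case trans (sym (two-parts-%3 p q p%3≡2 q%3≡2)) Σ%3≡2 of λ ()
sum-%3≡2⇒lengthOneMod3 {p ∷ q ∷ r ∷ ps} (p%3≡2 ∷ q%3≡2 ∷ r%3≡2 ∷ ps%3≡2) Σ%3≡2 =
  cons₃ p q r (sum-%3≡2⇒lengthOneMod3 ps%3≡2
    (trans (sym (three-parts-%3 p q r (sum ps) p%3≡2 q%3≡2 r%3≡2)) Σ%3≡2))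

encode : ℕ → List Token → List ℕ
encode ones []                = [ part ones ]
encode ones (one ∷ ts)        = encode (suc ones) ts
encode ones (block i j ∷ ts)  = part ones ∷ part i ∷ part j ∷ encode 0 ts

decode : List ℕ → List Token
decode []                 = []
decode (p ∷ [])           = replicate (p / 3) one
decode (p ∷ q ∷ [])       = []
decode (p ∷ q ∷ r ∷ ps)   = replicate (p / 3) one ++ block (q / 3) (r / 3) ∷ decode ps

encode-%3 : ∀ ones ts → All (λ p → p % 3 ≡ 2) (encode ones ts)
encode-%3 ones []               = part-%3 ones ∷ []
encode-%3 ones (one ∷ ts)       = encode-%3 (suc ones) ts
encode-%3 ones (block i j ∷ ts) = part-%3 ones ∷ part-%3 i ∷ part-%3 j ∷ encode-%3 0 ts

sum-encode : ∀ ones ts → sum (encode ones ts) ≡ part (ones + sum (map weight ts))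
sum-encode ones [] = trans (+-identityʳ (part ones)) (cong part (sym (+-identityʳ ones)))
sum-encode ones (one ∷ ts) =
  trans (sum-encode (suc ones) ts) (cong part (sym (+-suc ones (sum (map weight ts)))))
sum-encode ones (block i j ∷ ts) =
  trans (cong (λ s → part ones + (part i + (part j + s))) (sum-encode 0 ts))
        (identity ones i j (sum (map weight ts)))
  where
  identity : ∀ a i j w →
    (2 + a * 3) + ((2 + i * 3) + ((2 + j * 3) + (2 + (0 + w) * 3))) ≡ 2 + (a + (2 + i + j + w)) * 3
  identity = solve-∀

replicate-suc-++ : ∀ {A : Set} n (x : A) xs → replicate (suc n) x ++ xs ≡ replicate n x ++ x ∷ xs
replicate-suc-++ zero    x xs = refl
replicate-suc-++ (suc n) x xs = cong (x ∷_) (replicate-suc-++ n x xs)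

decode-encode : ∀ ones ts → decode (encode ones ts) ≡ replicate ones one ++ ts
decode-encode ones [] rewrite part-/3 ones = sym (++-identityʳ (replicate ones one))
decode-encode ones (one ∷ ts) = trans (decode-encode (suc ones) ts) (replicate-suc-++ ones one ts)
decode-encode ones (block i j ∷ ts) rewrite part-/3 ones | part-/3 i | part-/3 j =
  cong (λ ts′ → replicate ones one ++ block i j ∷ ts′) (decode-encode 0 ts)

encode-ones : ∀ k ts → encode 0 (replicate k one ++ ts) ≡ encode k ts
encode-ones k ts = trans (go k 0) (cong (λ a → encode a ts) (+-identityʳ k))
  where
  go : ∀ k ones → encode ones (replicate k one ++ ts) ≡ encode (k + ones) ts
  go zero    ones = refl
  go (suc k) ones = trans (go k (suc ones)) (cong (λ a → encode a ts) (+-suc k ones))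

encode-decode : ∀ {ps} → All (λ p → p % 3 ≡ 2) ps → LengthOneMod3 ps → encode 0 (decode ps) ≡ ps
encode-decode (p%3≡2 ∷ []) (single p) = begin
  encode 0 (replicate (p / 3) one)        ≡⟨ cong (encode 0) (++-identityʳ (replicate (p / 3) one)) ⟨
  encode 0 (replicate (p / 3) one ++ [])  ≡⟨ encode-ones (p / 3) [] ⟩
  [ part (p / 3) ]                        ≡⟨ cong [_] (part-/3-inverse p p%3≡2) ⟩
  [ p ]                                   ∎
encode-decode (p%3≡2 ∷ q%3≡2 ∷ r%3≡2 ∷ ps%3≡2) (cons₃ p q r ps) =
  trans (encode-ones (p / 3) _)
    (cong₂ _∷_ (part-/3-inverse p p%3≡2) (cong₂ _∷_ (part-/3-inverse q q%3≡2)
      (cong₂ _∷_ (part-/3-inverse r r%3≡2) (encode-decode ps%3≡2 ps))))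

parts2mod3-≡ : ∀ {N} {x y : CompositionParts2mod3 N} → proj₁ (proj₁ x) ≡ proj₁ (proj₁ y) → x ≡ y
parts2mod3-≡ {x = (ps , pos , e) , mod} {y = (.ps , pos′ , e′) , mod′} refl
  rewrite All.irrelevant ≤-irrelevant pos pos′ | ≡-irrelevant e e′
        | All.irrelevant ≡-irrelevant mod mod′ = refl

word↔parts2mod3 : ∀ n → Word n ↔ CompositionParts2mod3 (3 * n + 2)
word↔parts2mod3 n = mk↔ₛ′ to from to-from from-to
  where
  lengthOneMod3 : ∀ {ps} → All (λ p → p % 3 ≡ 2) ps → sum ps ≡ 3 * n + 2 → LengthOneMod3 ps
  lengthOneMod3 mod Σps≡N =
    sum-%3≡2⇒lengthOneMod3 mod (trans (cong (_% 3) (trans Σps≡N (sym (part≡3*+2 n)))) (part-%3 n))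

  to : Word n → CompositionParts2mod3 (3 * n + 2)
  to (ts , Σts≡n) =
    (encode 0 ts , All.map %3≡2⇒positive (encode-%3 0 ts)
    , trans (sum-encode 0 ts) (trans (cong part Σts≡n) (part≡3*+2 n)))
    , encode-%3 0 ts

  from : CompositionParts2mod3 (3 * n + 2) → Word n
  from ((ps , _ , Σps≡N) , mod) = decode ps , part-injective (begin
    part (sum (map weight (decode ps)))  ≡⟨ sum-encode 0 (decode ps) ⟨
    sum (encode 0 (decode ps))           ≡⟨ cong sum (encode-decode mod (lengthOneMod3 mod Σps≡N)) ⟩
    sum ps                               ≡⟨ trans Σps≡N (sym (part≡3*+2 n)) ⟩
    part n                               ∎)

  to-from : ∀ y → to (from y) ≡ y
  to-from ((ps , _ , Σps≡N) , mod) = parts2mod3-≡ (encode-decode mod (lengthOneMod3 mod Σps≡N))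

  from-to : ∀ w → from (to w) ≡ w
  from-to (ts , _) = word-≡ (decode-encode 0 ts)

proposition13 : (n : ℕ) → 1 ≤ n → NColorCompositionNo2 n ⤖ CompositionParts2mod3 (3 * n + 2)
-- The correspondence holds for n = 0 as well.
proposition13 n _ = ↔⇒⤖ (↔-trans (colored↔word n) (word↔parts2mod3 n))
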